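{- Let $G$ be a graph with $n$ vertices and minimum degree $\delta \ge 1$. Then $$\operatorname{avd}(G) \le \frac{n}{2}\left(1 + \frac{\delta}{2^{\delta} - 1}\right).$$ In particular, if $\delta \ge 2\log_2(n)$ then $\operatorname{avd}(G) \le \frac{n+1}{2}$.
   Context: Graphs are finite and simple. A set $S \subseteq V(G)$ is a dominating set of $G$ if every vertex of $G$ is in $S$ or adjacent to a vertex of $S$. Let $\mathcal{D}(G)$ be the collection of dominating sets of $G$. The average order of dominating sets is $\operatorname{avd}(G) = \frac{1}{|\mathcal{D}(G)|}\sum_{S \in \mathcal{D}(G)} |S|$. -}

module Defs where

open import Data.Bool using (Bool; true; false; _∧_; _∨_; T)
open import Data.Nat using (ℕ; zero; suc; _+_; _≤_)
open import Data.Fin using (Fin)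
open import Data.Fin.Subset using (Subset; inside; outside; ∣_∣)
open import Data.List using (List; []; _∷_; [_]; map; _++_; filter; length)
open import Data.Nat.ListAction using (sum)
open import Data.Product using (_×_; Σ)
open import Data.Vec using (_∷_; []; lookup)
open import Data.Vec.Functional using (foldr)
open import Data.Integer using (ℤ; +_)
open import Data.Rational using (ℚ; _/_; 0ℚ)
open import Relation.Binary.PropositionalEquality using (_≡_)
open import Relation.Nullary.Decidable using (T?)

record Graph (n : ℕ) : Set where
  field
    adj     : Fin n → Fin n → Bool
    symm    : ∀ u v → adj u v ≡ adj v u
    irrefl  : ∀ v → adj v v ≡ false
open Graph public

anyV : ∀ {n} → (Fin n → Bool) → Bool
anyV f = foldr _∨_ false f

allV : ∀ {n} → (Fin n → Bool) → Bool
allV f = foldr _∧_ true f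

countV : ∀ {n} → (Fin n → Bool) → ℕ
countV f = foldr (λ b k → (if′ b) + k) 0 f
  where
  if′ : Bool → ℕ
  if′ true  = 1
  if′ false = 0

deg : ∀ {n} → Graph n → Fin n → ℕ
deg G v = countV (λ u → adj G v u)

IsMinDegree : ∀ {n} → Graph n → ℕ → Set
IsMinDegree {n} G δ = (∀ v → δ ≤ deg G v) × Σ (Fin n) (λ v → deg G v ≡ δ)

isDominating : ∀ {n} → Graph n → Subset n → Bool
isDominating G S = allV (λ v → lookup S v ∨ anyV (λ u → lookup S u ∧ adj G u v))

allSubsets : ∀ n → List (Subset n)
allSubsets zero    = [ [] ]
allSubsets (suc n) = map (outside ∷_) (allSubsets n) ++ map (inside ∷_) (allSubsets n)

dominatingSets : ∀ {n} → Graph n → List (Subset n)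
dominatingSets {n} G = filter (λ S → T? (isDominating G S)) (allSubsets n)

-- division of an integer by a natural number as a rational
-- (convention p / 0 = 0; only used with nonzero denominators)
divℚ : ℤ → ℕ → ℚ
divℚ p zero    = 0ℚ
divℚ p (suc k) = p / suc k

avd : ∀ {n} → Graph n → ℚ
avd G = divℚ (+ sum (map ∣_∣ (dominatingSets G))) (length (dominatingSets G))

module Submission where

-- Let M be the number of dominating sets and A their total size, so avd(G) = A/M.
-- Call v critical for a dominating set S ∋ v if S − v is not dominating.  Deleting v
-- gives A = C + B and nM = A + C, where C counts pairs (v, S) with v ∉ S and B the
-- critical pairs.  A critical v has no neighbour in S, or a private neighbour w ∉ S
-- whose only neighbour in S is v; so B ≤ I + P accordingly.  Fixing S outside N(v),
-- the dominating sets form an up-set in the cube of subsets of N(v), of dimension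
-- deg v ≥ δ.  An up-set containing ∅ is the whole cube, giving I·2^δ ≤ A, and an
-- up-set with s singletons has at least s(2^d - 1)/d nonempty members, giving
-- P(2^δ - 1) ≤ δC.  Hence 2(2^δ - 1)A ≤ n(2^δ - 1 + δ)M, which is the theorem.

open import Defs
open import Data.Nat using (ℕ; _≤_; _^_; _∸_; _+_; _*_)
open import Data.Integer using (+_)
open import Data.Rational using (ℚ; 1ℚ) renaming (_≤_ to _≤ℚ_; _*_ to _*ℚ_; _+_ to _+ℚ_)
open import Data.Product using (_×_)

import Data.Nat.Properties as ℕP
open import Algebra.Properties.CommutativeSemigroup ℕP.+-commutativeSemigroup
  using () renaming (interchange to +-interchange)
open import Algebra.Properties.Semiring.Sum ℕP.+-*-semiring
  using (sum-syntax; ∑-distrib-+; ∑-comm; sum-cong-≗; *-distribˡ-sum; *-distribʳ-sum;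
         sum-replicate-zero)
  renaming (sum to ∑)
open import Data.Bool using (Bool; true; false; _∧_; _∨_; not)
open import Data.Bool.Properties
  using (∨-zeroʳ; ∧-comm; ∧-identityʳ; ∨-conicalˡ; ∨-conicalʳ; ∧-conicalˡ; ∧-conicalʳ)
open import Data.Empty using (⊥-elim)
open import Data.Fin using (Fin; zero; suc)
import Data.Fin.Properties as FinP
open import Data.Fin.Subset using (Subset; ∣_∣; _∩_) renaming (⊥ to ∅)
open import Data.Fin.Subset.Properties using (∣p∣≤n)
import Data.Integer as ℤ
import Data.Integer.Properties as ℤP
open import Data.List using ([]; _∷_; map; _++_; filter; length)
open import Data.List.Properties using (map-++; map-∘)
open import Data.Nat using (zero; suc; pred; z≤n; s≤s; _≤′_; ≤′-refl; ≤′-step; _≡ᵇ_; >-nonZero)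
open import Data.Nat.ListAction using (sum)
open import Data.Nat.ListAction.Properties using (sum-++)
open import Data.Nat.Tactic.RingSolver using (solve-∀)
open import Data.Product using (Σ; _,_)
open import Data.Rational using (toℚᵘ)
open import Data.Rational.Properties using (toℚᵘ-cancel-≤; toℚᵘ-fromℚᵘ; toℚᵘ-homo-*; toℚᵘ-homo-+)
open import Data.Rational.Unnormalised using (mkℚᵘ; ↥_; ↧_; *≤*; *≡*)
  renaming (_≤_ to _≤ᵘ_; _≃_ to _≃ᵘ_; _*_ to _ᵘ*_; _+_ to _ᵘ+_)
import Data.Rational.Unnormalised.Properties as ℚᵘP
open import Data.Sum using (inj₁; inj₂)
open import Data.Vec using ([]; _∷_; lookup; tabulate; _[_]≔_)
open import Data.Vec.Properties using (lookup∘tabulate; lookup-zipWith; lookup∘update; lookup∘update′)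
open import Relation.Binary.PropositionalEquality
open import Relation.Nullary using (yes; no)
open import Relation.Nullary.Decidable using (T?)

true≢false : true ≢ false
true≢false ()

⟦_⟧ : Bool → ℕ
⟦ true ⟧  = 1
⟦ false ⟧ = 0

⟦∧⟧ : ∀ a b → ⟦ a ∧ b ⟧ ≡ ⟦ a ⟧ * ⟦ b ⟧
⟦∧⟧ true  b = sym (ℕP.*-identityˡ ⟦ b ⟧)
⟦∧⟧ false b = refl

⟦⟧≤1 : ∀ a → ⟦ a ⟧ ≤ 1
⟦⟧≤1 true  = s≤s z≤n
⟦⟧≤1 false = z≤n

⟦⟧-mono : ∀ {a b} → (a ≡ true → b ≡ true) → ⟦ a ⟧ ≤ ⟦ b ⟧
⟦⟧-mono {false}         _   = z≤n
⟦⟧-mono {true}  {true}  _   = ℕP.≤-refl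
⟦⟧-mono {true}  {false} a⇒b with a⇒b refl
... | ()

⟦⟧*-≤ : ∀ a m → ⟦ a ⟧ * m ≤ m
⟦⟧*-≤ true  m = ℕP.≤-reflexive (ℕP.*-identityˡ m)
⟦⟧*-≤ false m = z≤n

Σₛ : ∀ {n} → (Subset n → ℕ) → ℕ
Σₛ {zero}  f = f []
Σₛ {suc n} f = Σₛ (λ S → f (false ∷ S)) + Σₛ (λ S → f (true ∷ S))

Σₛ-cong : ∀ {n} {f g : Subset n → ℕ} → (∀ S → f S ≡ g S) → Σₛ f ≡ Σₛ g
Σₛ-cong {zero}  f≡g = f≡g []
Σₛ-cong {suc n} f≡g =
  cong₂ _+_ (Σₛ-cong (λ S → f≡g (false ∷ S))) (Σₛ-cong (λ S → f≡g (true ∷ S)))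

Σₛ-mono : ∀ {n} {f g : Subset n → ℕ} → (∀ S → f S ≤ g S) → Σₛ f ≤ Σₛ g
Σₛ-mono {zero}  f≤g = f≤g []
Σₛ-mono {suc n} f≤g =
  ℕP.+-mono-≤ (Σₛ-mono (λ S → f≤g (false ∷ S))) (Σₛ-mono (λ S → f≤g (true ∷ S)))

Σₛ-zero : ∀ {n} → Σₛ {n} (λ _ → 0) ≡ 0
Σₛ-zero {zero}  = refl
Σₛ-zero {suc n} = cong₂ _+_ (Σₛ-zero {n}) (Σₛ-zero {n})

Σₛ-one : ∀ {n} → Σₛ {n} (λ _ → 1) ≡ 2 ^ n
Σₛ-one {zero}  = refl
Σₛ-one {suc n} = begin
  Σₛ {n} (λ _ → 1) + Σₛ {n} (λ _ → 1) ≡⟨ cong₂ _+_ (Σₛ-one {n}) (Σₛ-one {n}) ⟩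
  2 ^ n + 2 ^ n                       ≡⟨ cong (_+_ (2 ^ n)) (sym (ℕP.+-identityʳ (2 ^ n))) ⟩
  2 ^ suc n                           ∎
  where open ≡-Reasoning

Σₛ-+ : ∀ {n} (f g : Subset n → ℕ) → Σₛ (λ S → f S + g S) ≡ Σₛ f + Σₛ g
Σₛ-+ {zero}  f g = refl
Σₛ-+ {suc n} f g = begin
  Σₛ (λ S → f₀ S + g₀ S) + Σₛ (λ S → f₁ S + g₁ S)
    ≡⟨ cong₂ _+_ (Σₛ-+ f₀ g₀) (Σₛ-+ f₁ g₁) ⟩
  (Σₛ f₀ + Σₛ g₀) + (Σₛ f₁ + Σₛ g₁)
    ≡⟨ +-interchange (Σₛ f₀) (Σₛ g₀) (Σₛ f₁) (Σₛ g₁) ⟩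
  (Σₛ f₀ + Σₛ f₁) + (Σₛ g₀ + Σₛ g₁) ∎
  where
  open ≡-Reasoning
  f₀ f₁ g₀ g₁ : Subset n → ℕ
  f₀ S = f (false ∷ S)
  f₁ S = f (true ∷ S)
  g₀ S = g (false ∷ S)
  g₁ S = g (true ∷ S)

Σₛ-*ˡ : ∀ {n} k (f : Subset n → ℕ) → Σₛ (λ S → k * f S) ≡ k * Σₛ f
Σₛ-*ˡ {zero}  k f = refl
Σₛ-*ˡ {suc n} k f =
  trans (cong₂ _+_ (Σₛ-*ˡ k (λ S → f (false ∷ S))) (Σₛ-*ˡ k (λ S → f (true ∷ S))))
        (sym (ℕP.*-distribˡ-+ k _ _))

Σₛ-*ʳ : ∀ {n} k (f : Subset n → ℕ) → Σₛ (λ S → f S * k) ≡ Σₛ f * k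
Σₛ-*ʳ k f = trans (Σₛ-cong (λ S → ℕP.*-comm (f S) k))
                  (trans (Σₛ-*ˡ k f) (ℕP.*-comm k (Σₛ f)))

Σₛ-∑-comm : ∀ {n m} (f : Fin m → Subset n → ℕ) →
  Σₛ (λ S → ∑[ v < m ] f v S) ≡ ∑[ v < m ] Σₛ (f v)
Σₛ-∑-comm {n} {zero}  f = Σₛ-zero {n}
Σₛ-∑-comm {n} {suc m} f =
  trans (Σₛ-+ (f zero) (λ S → ∑[ v < m ] f (suc v) S))
        (cong (_+_ (Σₛ (f zero))) (Σₛ-∑-comm (λ v → f (suc v))))

-- Deleting v is a bijection from the sets containing v to the sets avoiding v:
-- the sum of h over S ∌ v equals the sum of h (S − v) over S ∋ v.
Σₛ-delete : ∀ {n} (v : Fin n) (h : Subset n → ℕ) →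
  Σₛ (λ S → ⟦ not (lookup S v) ⟧ * h S) ≡ Σₛ (λ S → ⟦ lookup S v ⟧ * h (S [ v ]≔ false))
Σₛ-delete {suc n} zero    h = ℕP.+-comm (Σₛ (λ S → 1 * h (false ∷ S))) (Σₛ {n} (λ _ → 0))
Σₛ-delete {suc n} (suc v) h =
  cong₂ _+_ (Σₛ-delete v (λ S → h (false ∷ S))) (Σₛ-delete v (λ S → h (true ∷ S)))

_⊆_ : ∀ {n} → Subset n → Subset n → Set
X ⊆ Y = ∀ i → lookup X i ≡ true → lookup Y i ≡ true

∅-⊆ : ∀ {d} (X : Subset d) → ∅ ⊆ X
∅-⊆ (x ∷ X) (suc i) i∈∅ = ∅-⊆ X i i∈∅

∷-⊆ : ∀ {d} b (X Y : Subset d) → X ⊆ Y → (b ∷ X) ⊆ (b ∷ Y)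
∷-⊆ b X Y X⊆Y zero    = λ b≡true → b≡true
∷-⊆ b X Y X⊆Y (suc i) = X⊆Y i

false∷-⊆-true∷ : ∀ {d} (X : Subset d) → (false ∷ X) ⊆ (true ∷ X)
false∷-⊆-true∷ X zero    ()
false∷-⊆-true∷ X (suc i) = λ i∈X → i∈X

UpClosed : ∀ {d} → (Subset d → Bool) → Set
UpClosed g = ∀ X Y → X ⊆ Y → g X ≡ true → g Y ≡ true

UpClosed-tail : ∀ {d} {g : Subset (suc d) → Bool} b → UpClosed g → UpClosed (λ X → g (b ∷ X))
UpClosed-tail b up X Y X⊆Y = up (b ∷ X) (b ∷ Y) (∷-⊆ b X Y X⊆Y)

Σₛ-size0 : ∀ {d} (f : Subset d → ℕ) → Σₛ (λ X → ⟦ ∣ X ∣ ≡ᵇ 0 ⟧ * f X) ≡ f ∅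
Σₛ-size0 {zero}  f = ℕP.*-identityˡ (f [])
Σₛ-size0 {suc d} f = begin
  Σₛ (λ X → ⟦ ∣ X ∣ ≡ᵇ 0 ⟧ * f (false ∷ X)) + Σₛ {d} (λ _ → 0)
    ≡⟨ cong₂ _+_ (Σₛ-size0 (λ X → f (false ∷ X))) (Σₛ-zero {d}) ⟩
  f ∅ + 0
    ≡⟨ ℕP.+-identityʳ (f ∅) ⟩
  f ∅ ∎
  where open ≡-Reasoning

Σₛ-size1 : ∀ {d} → Σₛ {d} (λ X → ⟦ ∣ X ∣ ≡ᵇ 1 ⟧) ≡ d
Σₛ-size1 {zero}  = refl
Σₛ-size1 {suc d} = begin
  Σₛ {d} (λ X → ⟦ ∣ X ∣ ≡ᵇ 1 ⟧) + Σₛ {d} (λ X → ⟦ ∣ X ∣ ≡ᵇ 0 ⟧)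
    ≡⟨ cong₂ _+_ (Σₛ-size1 {d}) (Σₛ-cong {d} (λ X → sym (ℕP.*-identityʳ ⟦ ∣ X ∣ ≡ᵇ 0 ⟧))) ⟩
  d + Σₛ {d} (λ X → ⟦ ∣ X ∣ ≡ᵇ 0 ⟧ * 1)
    ≡⟨ cong (_+_ d) (Σₛ-size0 {d} (λ _ → 1)) ⟩
  d + 1
    ≡⟨ ℕP.+-comm d 1 ⟩
  suc d ∎
  where open ≡-Reasoning

upset-with-∅ : ∀ {d} (g : Subset d → Bool) → UpClosed g → g ∅ ≡ true →
  Σₛ (λ X → ⟦ g X ⟧) ≡ 2 ^ d
upset-with-∅ {d} g up g∅ =
  trans (Σₛ-cong {g = λ _ → 1} (λ X → cong ⟦_⟧ (up ∅ X (∅-⊆ X) g∅))) (Σₛ-one {d})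

upset-∅-bound : ∀ {d} (g : Subset d → Bool) → UpClosed g →
  ⟦ g ∅ ⟧ * 2 ^ d ≤ Σₛ (λ X → ⟦ g X ⟧)
upset-∅-bound g up with g ∅ in g∅
... | false = z≤n
... | true  = ℕP.≤-reflexive (trans (ℕP.*-identityˡ _) (sym (upset-with-∅ g up g∅)))

-- The two arithmetic steps of the induction in `upset-singletons`, where s, t
-- count the singletons and nonempty members of the lower half of an up-set,
-- T the members of its upper half, and P = 2ᵈ.  First, when the new
-- coordinate adds no singleton:
double-step : ∀ s P d t T → s * P ≤ d * t + s → s ≤ t → t ≤ T →
  s * (2 * P) ≤ suc d * (t + T) + s
double-step s P d t T IH s≤t t≤T = begin
  s * (2 * P)      ≡⟨ regroup s P ⟩
  2 * (s * P)      ≤⟨ ℕP.*-monoʳ-≤ 2 (ℕP.≤-trans IH (ℕP.+-monoʳ-≤ (d * t) s≤t)) ⟩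
  2 * (d * t + t)  ≡⟨ regroup′ d t ⟩
  suc d * (t + t)  ≤⟨ ℕP.*-monoʳ-≤ (suc d) (ℕP.+-monoʳ-≤ t t≤T) ⟩
  suc d * (t + T)  ≤⟨ ℕP.m≤m+n _ s ⟩
  suc d * (t + T) + s ∎
  where
  open ℕP.≤-Reasoning
  regroup : ∀ s P → s * (2 * P) ≡ 2 * (s * P)
  regroup = solve-∀
  regroup′ : ∀ d t → 2 * (d * t + t) ≡ suc d * (t + t)
  regroup′ = solve-∀

-- Second, when it adds the singleton {0}; then the upper half is the whole
-- d-cube, so 2ᵈ ≤ T.
extend-step : ∀ s d t T → s * 2 ^ d ≤ d * t + s → s ≤ d → 2 ^ d ≤ T →
  (s + 1) * (2 * 2 ^ d) ≤ suc d * (t + T) + (s + 1)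
extend-step s d t T IH s≤d P≤T with ℕP.m≤n⇒m<n∨m≡n s≤d
... | inj₁ s<d = begin
  (s + 1) * (2 * P)              ≡⟨ split s P ⟩
  s * P + suc (suc s) * P        ≤⟨ ℕP.+-mono-≤ IH (ℕP.*-monoˡ-≤ P (s≤s s<d)) ⟩
  (d * t + s) + suc d * P        ≤⟨ ℕP.+-mono-≤ (ℕP.+-monoˡ-≤ s (ℕP.m≤n+m (d * t) t))
                                                (ℕP.*-monoʳ-≤ (suc d) P≤T) ⟩
  (suc d * t + s) + suc d * T    ≡⟨ merge d t T s ⟩
  suc d * (t + T) + s            ≤⟨ ℕP.+-monoʳ-≤ (suc d * (t + T)) (ℕP.m≤m+n s 1) ⟩
  suc d * (t + T) + (s + 1)      ∎
  where
  open ℕP.≤-Reasoning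
  P = 2 ^ d
  split : ∀ s P → (s + 1) * (2 * P) ≡ s * P + suc (suc s) * P
  split = solve-∀
  merge : ∀ d t T s → (suc d * t + s) + suc d * T ≡ suc d * (t + T) + s
  merge = solve-∀
... | inj₂ refl = begin
  (d + 1) * (2 * P)              ≡⟨ double d P ⟩
  suc d * (P + P)                ≤⟨ ℕP.*-monoʳ-≤ (suc d) (ℕP.+-mono-≤ P≤T (P≤t+1 d IH)) ⟩
  suc d * (T + (t + 1))          ≡⟨ spread d t T ⟩
  suc d * (t + T) + (d + 1)      ∎
  where
  open ℕP.≤-Reasoning
  P = 2 ^ d
  double : ∀ d P → (d + 1) * (2 * P) ≡ suc d * (P + P)
  double = solve-∀
  spread : ∀ d t T → suc d * (T + (t + 1)) ≡ suc d * (t + T) + (d + 1)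
  spread = solve-∀
  P≤t+1 : ∀ d → d * 2 ^ d ≤ d * t + d → 2 ^ d ≤ t + 1
  P≤t+1 zero    _  = ℕP.m≤n+m 1 t
  P≤t+1 (suc e) le = ℕP.*-cancelˡ-≤ (suc e)
    (ℕP.≤-trans le (ℕP.≤-reflexive (sym (trans (ℕP.*-distribˡ-+ (suc e) t 1)
                                              (cong (_+_ (suc e * t)) (ℕP.*-identityʳ (suc e)))))))

singletons nonempty : ∀ {d} → (Subset d → Bool) → ℕ
singletons g = Σₛ (λ X → ⟦ g X ⟧ * ⟦ ∣ X ∣ ≡ᵇ 1 ⟧)
nonempty   g = Σₛ (λ X → ⟦ g X ⟧ * ⟦ not (∣ X ∣ ≡ᵇ 0) ⟧)

upset-singletons : ∀ {d} (g : Subset d → Bool) → UpClosed g →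
  singletons g * 2 ^ d ≤ d * nonempty g + singletons g
upset-singletons {zero}  g up = ℕP.≤-reflexive (ℕP.*-identityʳ _)
upset-singletons {suc d} g up =
  subst (λ e → (s₀ + e) * 2 ^ suc d ≤ suc d * (t₀ + T) + (s₀ + e)) (sym singleton₀) step
  where
  g₀ g₁ : Subset d → Bool
  g₀ X = g (false ∷ X)
  g₁ X = g (true ∷ X)
  s₀ t₀ T : ℕ
  s₀ = singletons g₀
  t₀ = nonempty g₀
  T  = Σₛ (λ X → ⟦ g₁ X ⟧ * 1)
  -- the new singleton {0} lies in g iff ∅ lies in g₁
  singleton₀ : Σₛ (λ X → ⟦ g₁ X ⟧ * ⟦ ∣ X ∣ ≡ᵇ 0 ⟧) ≡ ⟦ g₁ ∅ ⟧
  singleton₀ = trans (Σₛ-cong (λ X → ℕP.*-comm ⟦ g₁ X ⟧ _)) (Σₛ-size0 (λ X → ⟦ g₁ X ⟧))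
  IH : s₀ * 2 ^ d ≤ d * t₀ + s₀
  IH = upset-singletons g₀ (UpClosed-tail false up)
  s₀≤t₀ : s₀ ≤ t₀
  s₀≤t₀ = Σₛ-mono (λ X → ℕP.*-monoʳ-≤ ⟦ g₀ X ⟧ (size1⇒nonempty ∣ X ∣))
    where
    size1⇒nonempty : ∀ k → ⟦ k ≡ᵇ 1 ⟧ ≤ ⟦ not (k ≡ᵇ 0) ⟧
    size1⇒nonempty zero    = z≤n
    size1⇒nonempty (suc k) = ⟦⟧≤1 (k ≡ᵇ 0)
  t₀≤T : t₀ ≤ T
  t₀≤T = Σₛ-mono lower⊆upper
    where
    lower⊆upper : ∀ X → ⟦ g₀ X ⟧ * ⟦ not (∣ X ∣ ≡ᵇ 0) ⟧ ≤ ⟦ g₁ X ⟧ * 1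
    lower⊆upper X = ℕP.*-mono-≤ (⟦⟧-mono (up (false ∷ X) (true ∷ X) (false∷-⊆-true∷ X))) (⟦⟧≤1 _)
  s₀≤d : s₀ ≤ d
  s₀≤d = ℕP.≤-trans (Σₛ-mono (λ X → ⟦⟧*-≤ (g₀ X) _)) (ℕP.≤-reflexive (Σₛ-size1 {d}))
  step : (s₀ + ⟦ g₁ ∅ ⟧) * (2 * 2 ^ d) ≤ suc d * (t₀ + T) + (s₀ + ⟦ g₁ ∅ ⟧)
  step with g₁ ∅ in g₁∅
  ... | false = subst (λ x → x * (2 * 2 ^ d) ≤ suc d * (t₀ + T) + x) (sym (ℕP.+-identityʳ s₀))
                      (double-step s₀ (2 ^ d) d t₀ T IH s₀≤t₀ t₀≤T)
  ... | true  = extend-step s₀ d t₀ T IH s₀≤d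
                  (ℕP.≤-reflexive (trans (sym (upset-with-∅ g₁ (UpClosed-tail true up) g₁∅))
                                         (Σₛ-cong (λ X → sym (ℕP.*-identityʳ ⟦ g₁ X ⟧)))))

-- Fibres over Z ⊆ Fin n.  The fibre through R consists of the sets agreeing
-- with R outside Z; it is a copy of the ∣Z∣-cube, the set `embed Z R X` being
-- the member whose trace on Z is X.
embed : ∀ {n} (Z R : Subset n) → Subset ∣ Z ∣ → Subset n
embed []          []      []      = []
embed (false ∷ Z) (r ∷ R) X       = r ∷ embed Z R X
embed (true ∷ Z)  (r ∷ R) (x ∷ X) = x ∷ embed Z R X

embed-trace : ∀ {n} (Z R : Subset n) X → ∣ Z ∩ embed Z R X ∣ ≡ ∣ X ∣
embed-trace []          []      []          = refl
embed-trace (false ∷ Z) (r ∷ R) X           = embed-trace Z R X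
embed-trace (true ∷ Z)  (r ∷ R) (false ∷ X) = embed-trace Z R X
embed-trace (true ∷ Z)  (r ∷ R) (true ∷ X)  = cong suc (embed-trace Z R X)

embed-outside : ∀ {n} (Z R : Subset n) X v → lookup Z v ≡ false →
  lookup (embed Z R X) v ≡ lookup R v
embed-outside (false ∷ Z) (r ∷ R) X       zero    v∉Z = refl
embed-outside (false ∷ Z) (r ∷ R) X       (suc v) v∉Z = embed-outside Z R X v v∉Z
embed-outside (true ∷ Z)  (r ∷ R) (x ∷ X) (suc v) v∉Z = embed-outside Z R X v v∉Z

embed-mono : ∀ {n} (Z R : Subset n) X Y → X ⊆ Y → embed Z R X ⊆ embed Z R Y
embed-mono (false ∷ Z) (r ∷ R) X       Y       X⊆Y zero    = λ r≡true → r≡true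
embed-mono (false ∷ Z) (r ∷ R) X       Y       X⊆Y (suc i) = embed-mono Z R X Y X⊆Y i
embed-mono (true ∷ Z)  (r ∷ R) (x ∷ X) (y ∷ Y) X⊆Y zero    = X⊆Y zero
embed-mono (true ∷ Z)  (r ∷ R) (x ∷ X) (y ∷ Y) X⊆Y (suc i) =
  embed-mono Z R X Y (λ j → X⊆Y (suc j)) i

-- Summing over all fibres counts every set 2 ^ ∣Z∣ times (once for each
-- choice of R on Z).
fibre-count : ∀ {n} (Z : Subset n) (h : Subset n → ℕ) →
  Σₛ (λ R → Σₛ (λ X → h (embed Z R X))) ≡ 2 ^ ∣ Z ∣ * Σₛ h
fibre-count []          h = sym (ℕP.*-identityˡ (h []))
fibre-count {suc n} (false ∷ Z) h = begin
  Σₛ (λ R → Σₛ (λ X → h₀ (embed Z R X))) + Σₛ (λ R → Σₛ (λ X → h₁ (embed Z R X)))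
    ≡⟨ cong₂ _+_ (fibre-count Z h₀) (fibre-count Z h₁) ⟩
  2 ^ ∣ Z ∣ * Σₛ h₀ + 2 ^ ∣ Z ∣ * Σₛ h₁
    ≡⟨ sym (ℕP.*-distribˡ-+ (2 ^ ∣ Z ∣) (Σₛ h₀) (Σₛ h₁)) ⟩
  2 ^ ∣ Z ∣ * (Σₛ h₀ + Σₛ h₁) ∎
  where
  open ≡-Reasoning
  h₀ h₁ : Subset n → ℕ
  h₀ S = h (false ∷ S)
  h₁ S = h (true ∷ S)
fibre-count {suc n} (true ∷ Z)  h = begin
  Q + Q                             ≡⟨ cong (λ q → q + q) Q≡ ⟩
  P * Σₛ h + P * Σₛ h               ≡⟨ twice P (Σₛ h) ⟩
  2 * P * Σₛ h                      ∎
  where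
  open ≡-Reasoning
  P = 2 ^ ∣ Z ∣
  h₀ h₁ : Subset n → ℕ
  h₀ S = h (false ∷ S)
  h₁ S = h (true ∷ S)
  -- the sum over the fibres through R, for either value of R on the first point
  Q : ℕ
  Q = Σₛ (λ R → Σₛ (λ X → h₀ (embed Z R X)) + Σₛ (λ X → h₁ (embed Z R X)))
  Q≡ : Q ≡ P * Σₛ h
  Q≡ = begin
    Q                                 ≡⟨ Σₛ-+ (λ R → Σₛ (λ X → h₀ (embed Z R X)))
                                              (λ R → Σₛ (λ X → h₁ (embed Z R X))) ⟩
    Σₛ (λ R → Σₛ (λ X → h₀ (embed Z R X))) + Σₛ (λ R → Σₛ (λ X → h₁ (embed Z R X)))
                                      ≡⟨ cong₂ _+_ (fibre-count Z h₀) (fibre-count Z h₁) ⟩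
    P * Σₛ h₀ + P * Σₛ h₁             ≡⟨ sym (ℕP.*-distribˡ-+ P (Σₛ h₀) (Σₛ h₁)) ⟩
    P * Σₛ h                          ∎
  twice : ∀ P s → P * s + P * s ≡ 2 * P * s
  twice = solve-∀

fibrewise-≤ : ∀ {n} (Z : Subset n) (F G : Subset n → ℕ) →
  (∀ R → Σₛ (λ X → F (embed Z R X)) ≤ Σₛ (λ X → G (embed Z R X))) → Σₛ F ≤ Σₛ G
fibrewise-≤ Z F G on-fibres = ℕP.*-cancelˡ-≤ (2 ^ ∣ Z ∣) (begin
  2 ^ ∣ Z ∣ * Σₛ F                        ≡⟨ sym (fibre-count Z F) ⟩
  Σₛ (λ R → Σₛ (λ X → F (embed Z R X)))  ≤⟨ Σₛ-mono on-fibres ⟩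
  Σₛ (λ R → Σₛ (λ X → G (embed Z R X)))  ≡⟨ fibre-count Z G ⟩
  2 ^ ∣ Z ∣ * Σₛ G                        ∎)
  where
  open ℕP.≤-Reasoning
  instance _ = ℕP.m^n≢0 2 ∣ Z ∣

UpClosedAlong : ∀ {n} → Subset n → (Subset n → Bool) → Set
UpClosedAlong Z g = ∀ R → UpClosed (λ X → g (embed Z R X))

avoiding meetingOnce meeting : ∀ {n} → Subset n → (Subset n → Bool) → ℕ
avoiding    Z g = Σₛ (λ S → ⟦ g S ⟧ * ⟦ ∣ Z ∩ S ∣ ≡ᵇ 0 ⟧)
meetingOnce Z g = Σₛ (λ S → ⟦ g S ⟧ * ⟦ ∣ Z ∩ S ∣ ≡ᵇ 1 ⟧)
meeting     Z g = Σₛ (λ S → ⟦ g S ⟧ * ⟦ not (∣ Z ∩ S ∣ ≡ᵇ 0) ⟧)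

Σₛ-trace : ∀ {n} (Z R : Subset n) (φ : Subset n → ℕ → ℕ) →
  Σₛ (λ X → φ (embed Z R X) ∣ Z ∩ embed Z R X ∣) ≡ Σₛ (λ X → φ (embed Z R X) ∣ X ∣)
Σₛ-trace Z R φ = Σₛ-cong (λ X → cong (φ (embed Z R X)) (embed-trace Z R X))

-- Each member of g avoiding Z starts a whole cube of members of g, so
-- these are at most a 2^-∣Z∣ fraction of g.
avoiding-bound : ∀ {n} (Z : Subset n) (g : Subset n → Bool) → UpClosedAlong Z g →
  avoiding Z g * 2 ^ ∣ Z ∣ ≤ Σₛ (λ S → ⟦ g S ⟧)
avoiding-bound {n} Z g up = begin
  avoiding Z g * P                                     ≡⟨ sym (Σₛ-*ʳ {n} P _) ⟩
  Σₛ (λ S → ⟦ g S ⟧ * ⟦ ∣ Z ∩ S ∣ ≡ᵇ 0 ⟧ * P)         ≤⟨ fibrewise-≤ Z _ _ on-fibre ⟩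
  Σₛ (λ S → ⟦ g S ⟧)                                   ∎
  where
  open ℕP.≤-Reasoning
  P = 2 ^ ∣ Z ∣
  on-fibre : ∀ R → Σₛ (λ X → ⟦ g (embed Z R X) ⟧ * ⟦ ∣ Z ∩ embed Z R X ∣ ≡ᵇ 0 ⟧ * P)
                     ≤ Σₛ (λ X → ⟦ g (embed Z R X) ⟧)
  on-fibre R = begin
    Σₛ (λ X → ⟦ g (embed Z R X) ⟧ * ⟦ ∣ Z ∩ embed Z R X ∣ ≡ᵇ 0 ⟧ * P)
      ≡⟨ Σₛ-trace Z R (λ S k → ⟦ g S ⟧ * ⟦ k ≡ᵇ 0 ⟧ * P) ⟩
    Σₛ (λ X → ⟦ g′ X ⟧ * ⟦ ∣ X ∣ ≡ᵇ 0 ⟧ * P)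
      ≡⟨ Σₛ-*ʳ {∣ Z ∣} P _ ⟩
    Σₛ (λ X → ⟦ g′ X ⟧ * ⟦ ∣ X ∣ ≡ᵇ 0 ⟧) * P
      ≡⟨ cong (_* P) (trans (Σₛ-cong {∣ Z ∣} (λ X → ℕP.*-comm ⟦ g′ X ⟧ _))
                            (Σₛ-size0 (λ X → ⟦ g′ X ⟧))) ⟩
    ⟦ g′ ∅ ⟧ * P
      ≤⟨ upset-∅-bound g′ (up R) ⟩
    Σₛ (λ X → ⟦ g′ X ⟧) ∎
    where
    g′ : Subset ∣ Z ∣ → Bool
    g′ X = g (embed Z R X)

meetingOnce-bound : ∀ {n} (Z : Subset n) (g : Subset n → Bool) → UpClosedAlong Z g →
  meetingOnce Z g * 2 ^ ∣ Z ∣ ≤ ∣ Z ∣ * meeting Z g + meetingOnce Z g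
meetingOnce-bound {n} Z g up = begin
  meetingOnce Z g * P                       ≡⟨ sym (Σₛ-*ʳ {n} P _) ⟩
  Σₛ (λ S → once S * P)                     ≤⟨ fibrewise-≤ Z _ _ on-fibre ⟩
  Σₛ (λ S → ∣ Z ∣ * meets S + once S)       ≡⟨ Σₛ-+ {n} _ _ ⟩
  Σₛ (λ S → ∣ Z ∣ * meets S) + meetingOnce Z g
                                            ≡⟨ cong (_+ meetingOnce Z g) (Σₛ-*ˡ {n} ∣ Z ∣ _) ⟩
  ∣ Z ∣ * meeting Z g + meetingOnce Z g     ∎
  where
  open ℕP.≤-Reasoning
  P = 2 ^ ∣ Z ∣
  once meets : Subset n → ℕ
  once  S = ⟦ g S ⟧ * ⟦ ∣ Z ∩ S ∣ ≡ᵇ 1 ⟧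
  meets S = ⟦ g S ⟧ * ⟦ not (∣ Z ∩ S ∣ ≡ᵇ 0) ⟧
  on-fibre : ∀ R → Σₛ (λ X → once (embed Z R X) * P)
                     ≤ Σₛ (λ X → ∣ Z ∣ * meets (embed Z R X) + once (embed Z R X))
  on-fibre R = begin
    Σₛ (λ X → once (embed Z R X) * P)
      ≡⟨ Σₛ-trace Z R (λ S k → ⟦ g S ⟧ * ⟦ k ≡ᵇ 1 ⟧ * P) ⟩
    Σₛ (λ X → ⟦ g′ X ⟧ * ⟦ ∣ X ∣ ≡ᵇ 1 ⟧ * P)
      ≡⟨ Σₛ-*ʳ {∣ Z ∣} P _ ⟩
    singletons g′ * P
      ≤⟨ upset-singletons g′ (up R) ⟩
    ∣ Z ∣ * nonempty g′ + singletons g′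
      ≡⟨ sym (cong₂ _+_ (Σₛ-*ˡ {∣ Z ∣} ∣ Z ∣ _) refl) ⟩
    Σₛ (λ X → ∣ Z ∣ * (⟦ g′ X ⟧ * ⟦ not (∣ X ∣ ≡ᵇ 0) ⟧)) + singletons g′
      ≡⟨ sym (Σₛ-+ {∣ Z ∣} _ _) ⟩
    Σₛ (λ X → ∣ Z ∣ * (⟦ g′ X ⟧ * ⟦ not (∣ X ∣ ≡ᵇ 0) ⟧) + ⟦ g′ X ⟧ * ⟦ ∣ X ∣ ≡ᵇ 1 ⟧)
      ≡⟨ sym (Σₛ-trace Z R (λ S k → ∣ Z ∣ * (⟦ g S ⟧ * ⟦ not (k ≡ᵇ 0) ⟧)
                                     + ⟦ g S ⟧ * ⟦ k ≡ᵇ 1 ⟧)) ⟩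
    Σₛ (λ X → ∣ Z ∣ * meets (embed Z R X) + once (embed Z R X)) ∎
    where
    g′ : Subset ∣ Z ∣ → Bool
    g′ X = g (embed Z R X)

all-elim : ∀ {n} (f : Fin n → Bool) → allV f ≡ true → ∀ v → f v ≡ true
all-elim {suc n} f every v with f zero in f0
all-elim {suc n} f every zero    | true = f0
all-elim {suc n} f every (suc v) | true = all-elim (λ i → f (suc i)) every v

all-intro : ∀ {n} (f : Fin n → Bool) → (∀ v → f v ≡ true) → allV f ≡ true
all-intro {zero}  f every = refl
all-intro {suc n} f every rewrite every zero = all-intro (λ i → f (suc i)) (λ v → every (suc v))

all-counterexample : ∀ {n} (f : Fin n → Bool) → allV f ≡ false → Σ (Fin n) (λ v → f v ≡ false)
all-counterexample {suc n} f notAll with f zero in f0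
... | false = zero , f0
... | true with all-counterexample (λ i → f (suc i)) notAll
...          | v , fv = suc v , fv

any-intro : ∀ {n} (f : Fin n → Bool) v → f v ≡ true → anyV f ≡ true
any-intro f zero    fv rewrite fv = refl
any-intro f (suc v) fv with f zero
... | true  = refl
... | false = any-intro (λ i → f (suc i)) v fv

any-witness : ∀ {n} (f : Fin n → Bool) → anyV f ≡ true → Σ (Fin n) (λ v → f v ≡ true)
any-witness {suc n} f some with f zero in f0
... | true  = zero , f0
... | false with any-witness (λ i → f (suc i)) some
...          | v , fv = suc v , fv

any-false : ∀ {n} (f : Fin n → Bool) → anyV f ≡ false → ∀ v → f v ≡ false
any-false f none v with f v in fv
... | false = refl
... | true  = trans (sym (any-intro f v fv)) none

∑-mono : ∀ {n} {f g : Fin n → ℕ} → (∀ v → f v ≤ g v) → ∑[ v < n ] f v ≤ ∑[ v < n ] g v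
∑-mono {zero}  f≤g = z≤n
∑-mono {suc n} f≤g = ℕP.+-mono-≤ (f≤g zero) (∑-mono (λ v → f≤g (suc v)))

∑-term : ∀ {n} (f : Fin n → ℕ) v → f v ≤ ∑[ i < n ] f i
∑-term f zero    = ℕP.m≤m+n _ _
∑-term f (suc v) = ℕP.≤-trans (∑-term (λ i → f (suc i)) v) (ℕP.m≤n+m _ (f zero))

∑-const : ∀ n m → ∑[ v < n ] m ≡ n * m
∑-const zero    m = refl
∑-const (suc n) m = cong (_+_ m) (∑-const n m)

∣S∣-∑ : ∀ {n} (S : Subset n) → ∣ S ∣ ≡ ∑[ v < n ] ⟦ lookup S v ⟧
∣S∣-∑ []          = refl
∣S∣-∑ (true ∷ S)  = cong suc (∣S∣-∑ S)
∣S∣-∑ (false ∷ S) = ∣S∣-∑ S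

∣tabulate∣ : ∀ {n} (f : Fin n → Bool) → ∣ tabulate f ∣ ≡ countV f
∣tabulate∣ {zero}  f = refl
∣tabulate∣ {suc n} f with f zero
... | true  = cong suc (∣tabulate∣ (λ i → f (suc i)))
... | false = ∣tabulate∣ (λ i → f (suc i))

missing⇒∣S∣<n : ∀ {n} (S : Subset n) v → lookup S v ≡ false → suc ∣ S ∣ ≤ n
missing⇒∣S∣<n (false ∷ S) zero    _   = s≤s (∣p∣≤n S)
missing⇒∣S∣<n (true ∷ S)  (suc v) v∉S = s≤s (missing⇒∣S∣<n S v v∉S)
missing⇒∣S∣<n (false ∷ S) (suc v) v∉S = ℕP.m≤n⇒m≤1+n (missing⇒∣S∣<n S v v∉S)

empty-intro : ∀ {n} (S : Subset n) → (∀ v → lookup S v ≡ false) → (∣ S ∣ ≡ᵇ 0) ≡ true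
empty-intro []      none = refl
empty-intro (x ∷ S) none rewrite none zero = empty-intro S (λ v → none (suc v))

isSingleton : ∀ {n} → Subset n → Fin n → Bool
isSingleton (x ∷ S) zero    = x ∧ (∣ S ∣ ≡ᵇ 0)
isSingleton (x ∷ S) (suc v) = not x ∧ isSingleton S v

singleton-intro : ∀ {n} (S : Subset n) v → lookup S v ≡ true →
  (∀ w → lookup S w ≡ true → w ≡ v) → isSingleton S v ≡ true
singleton-intro (x ∷ S) zero v∈S only-v rewrite v∈S = empty-intro S not-in
  where
  not-in : ∀ w → lookup S w ≡ false
  not-in w with lookup S w in w∈S
  ... | false = refl
  ... | true with only-v (suc w) w∈S
  ...          | ()
singleton-intro (true ∷ S)  (suc v) v∈S only-v with only-v zero refl
... | ()
singleton-intro (false ∷ S) (suc v) v∈S only-v =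
  singleton-intro S v v∈S (λ w w∈S → FinP.suc-injective (only-v (suc w) w∈S))

∑-isSingleton : ∀ {n} (S : Subset n) → ∑[ v < n ] ⟦ isSingleton S v ⟧ ≡ ⟦ ∣ S ∣ ≡ᵇ 1 ⟧
∑-isSingleton []          = refl
∑-isSingleton {suc n} (true ∷ S)  =
  trans (cong (_+_ (⟦ ∣ S ∣ ≡ᵇ 0 ⟧)) (sum-replicate-zero n)) (ℕP.+-identityʳ _)
∑-isSingleton (false ∷ S) = ∑-isSingleton S

-- (2ᵈ - 1) / d is nondecreasing for d ≥ 1, in the form d 2^δ + δ ≤ δ 2ᵈ + d.
ratio-mono : ∀ δ d → 1 ≤ δ → δ ≤ d → d * 2 ^ δ + δ ≤ δ * 2 ^ d + d
ratio-mono δ d 1≤δ δ≤d = go (ℕP.≤⇒≤′ δ≤d)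
  where
  go : ∀ {d} → δ ≤′ d → d * 2 ^ δ + δ ≤ δ * 2 ^ d + d
  go ≤′-refl = ℕP.≤-refl
  go {suc d} (≤′-step δ≤′d) = begin
    suc d * 2 ^ δ + δ              ≡⟨ peel d (2 ^ δ) δ ⟩
    (d * 2 ^ δ + δ) + 2 ^ δ        ≤⟨ ℕP.+-mono-≤ (go δ≤′d) 2^δ≤ ⟩
    (δ * 2 ^ d + d) + (δ * 2 ^ d + 1) ≡⟨ join δ (2 ^ d) d ⟩
    δ * 2 ^ suc d + suc d          ∎
    where
    open ℕP.≤-Reasoning
    peel : ∀ d P δ → suc d * P + δ ≡ (d * P + δ) + P
    peel = solve-∀
    join : ∀ δ Q d → (δ * Q + d) + (δ * Q + 1) ≡ δ * (2 * Q) + suc d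
    join = solve-∀
    2^δ≤ : 2 ^ δ ≤ δ * 2 ^ d + 1
    2^δ≤ = ℕP.≤-trans (ℕP.^-monoʳ-≤ 2 (ℕP.≤′⇒≤ δ≤′d))
             (ℕP.≤-trans (ℕP.m≤n*m (2 ^ d) δ) (ℕP.m≤m+n _ 1))
      where instance _ = >-nonZero 1≤δ

lower-dimension : ∀ s t d δ → 1 ≤ δ → δ ≤ d → s * 2 ^ d ≤ d * t + s → s * 2 ^ δ ≤ δ * t + s
lower-dimension s t d δ 1≤δ δ≤d bound = ℕP.*-cancelˡ-≤ d (ℕP.+-cancelʳ-≤ (s * δ) _ _ (begin
  d * (s * 2 ^ δ) + s * δ        ≡⟨ regroup d s (2 ^ δ) δ ⟩
  s * (d * 2 ^ δ + δ)            ≤⟨ ℕP.*-monoʳ-≤ s (ratio-mono δ d 1≤δ δ≤d) ⟩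
  s * (δ * 2 ^ d + d)            ≡⟨ regroup′ δ s (2 ^ d) d ⟩
  δ * (s * 2 ^ d) + s * d        ≤⟨ ℕP.+-monoˡ-≤ (s * d) (ℕP.*-monoʳ-≤ δ bound) ⟩
  δ * (d * t + s) + s * d        ≡⟨ regroup″ δ d t s ⟩
  d * (δ * t + s) + s * δ        ∎))
  where
  open ℕP.≤-Reasoning
  instance _ = >-nonZero (ℕP.≤-trans 1≤δ δ≤d)
  regroup : ∀ d s P δ → d * (s * P) + s * δ ≡ s * (d * P + δ)
  regroup = solve-∀
  regroup′ : ∀ δ s Q d → s * (δ * Q + d) ≡ δ * (s * Q) + s * d
  regroup′ = solve-∀
  regroup″ : ∀ δ d t s → δ * (d * t + s) + s * d ≡ d * (δ * t + s) + s * δ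
  regroup″ = solve-∀

combine : ∀ A B C I P T M n δ E → A ≡ C + B → n * M ≡ A + C → B ≤ I + P →
  I * suc E ≤ A → P * suc E ≤ δ * T + P → T ≤ C → 1 ≤ δ →
  A * (2 * E) ≤ n * (E + δ) * M
combine A B C I P T M n δ E A≡ nM≡ B≤ I-bound P-bound T≤C 1≤δ = begin
  A * (2 * E)              ≡⟨ double A E ⟩
  (A + A) * E              ≡⟨ cong (λ x → (A + x) * E) A≡ ⟩
  (A + (C + B)) * E        ≡⟨ split A C B E ⟩
  (A + C) * E + B * E      ≤⟨ ℕP.+-monoʳ-≤ ((A + C) * E) B*E≤ ⟩
  (A + C) * E + δ * (A + C) ≡⟨ merge (A + C) δ E ⟩
  (A + C) * (E + δ)        ≡⟨ cong (_* (E + δ)) (sym nM≡) ⟩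
  n * M * (E + δ)          ≡⟨ reorder n M E δ ⟩
  n * (E + δ) * M          ∎
  where
  open ℕP.≤-Reasoning
  instance _ = >-nonZero 1≤δ
  I*E≤ : I * E ≤ δ * A
  I*E≤ = ℕP.≤-trans (ℕP.*-monoʳ-≤ I (ℕP.n≤1+n E)) (ℕP.≤-trans I-bound (ℕP.m≤n*m A δ))
  P*E≤ : P * E ≤ δ * C
  P*E≤ = ℕP.≤-trans (ℕP.+-cancelˡ-≤ P _ _ (ℕP.≤-trans (ℕP.≤-reflexive (sym (ℕP.*-suc P E)))
                                           (ℕP.≤-trans P-bound (ℕP.≤-reflexive (ℕP.+-comm (δ * T) P)))))
                    (ℕP.*-monoʳ-≤ δ T≤C)
  B*E≤ : B * E ≤ δ * (A + C)
  B*E≤ = begin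
    B * E              ≤⟨ ℕP.*-monoˡ-≤ E B≤ ⟩
    (I + P) * E        ≡⟨ ℕP.*-distribʳ-+ E I P ⟩
    I * E + P * E      ≤⟨ ℕP.+-mono-≤ I*E≤ P*E≤ ⟩
    δ * A + δ * C      ≡⟨ sym (ℕP.*-distribˡ-+ δ A C) ⟩
    δ * (A + C)        ∎
  double : ∀ A E → A * (2 * E) ≡ (A + A) * E
  double = solve-∀
  split : ∀ A C B E → (A + (C + B)) * E ≡ (A + C) * E + B * E
  split = solve-∀
  merge : ∀ X δ E → X * E + δ * X ≡ X * (E + δ)
  merge = solve-∀
  reorder : ∀ n M E δ → n * M * (E + δ) ≡ n * (E + δ) * M
  reorder = solve-∀

halve : ∀ A M n δ E → A * (2 * E) ≤ n * (E + δ) * M → n * δ ≤ E → 1 ≤ E →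
  A * 2 ≤ (n + 1) * M
halve A M n δ E bound nδ≤E 1≤E = ℕP.*-cancelʳ-≤ (A * 2) ((n + 1) * M) E (begin
  A * 2 * E                 ≡⟨ ℕP.*-assoc A 2 E ⟩
  A * (2 * E)               ≤⟨ bound ⟩
  n * (E + δ) * M           ≡⟨ expand n E δ M ⟩
  n * E * M + n * δ * M     ≤⟨ ℕP.+-monoʳ-≤ (n * E * M) (ℕP.*-monoˡ-≤ M nδ≤E) ⟩
  n * E * M + E * M         ≡⟨ collect n E M ⟩
  (n + 1) * M * E           ∎)
  where
  open ℕP.≤-Reasoning
  instance _ = >-nonZero 1≤E
  expand : ∀ n E δ M → n * (E + δ) * M ≡ n * E * M + n * δ * M
  expand = solve-∀
  collect : ∀ n E M → n * E * M + E * M ≡ (n + 1) * M * E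
  collect = solve-∀

square-bound : ∀ n δ E → suc δ ≤ n → n * n ≤ suc E → n * δ ≤ E
square-bound n δ E δ<n n²≤ = ℕP.≤-pred (begin
  suc (n * δ)       ≡⟨ ℕP.+-comm 1 (n * δ) ⟩
  n * δ + 1         ≤⟨ ℕP.+-monoʳ-≤ (n * δ) (ℕP.≤-trans (s≤s z≤n) δ<n) ⟩
  n * δ + n         ≡⟨ ℕP.+-comm (n * δ) n ⟩
  n + n * δ         ≡⟨ sym (ℕP.*-suc n δ) ⟩
  n * suc δ         ≤⟨ ℕP.*-monoʳ-≤ n δ<n ⟩
  n * n             ≤⟨ n²≤ ⟩
  suc E             ∎)
  where open ℕP.≤-Reasoning

sum-allSubsets : ∀ n (f : Subset n → ℕ) → sum (map f (allSubsets n)) ≡ Σₛ f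
sum-allSubsets zero    f = ℕP.+-identityʳ (f [])
sum-allSubsets (suc n) f = begin
  sum (map f (map (false ∷_) Ss ++ map (true ∷_) Ss))
    ≡⟨ cong sum (map-++ f (map (false ∷_) Ss) (map (true ∷_) Ss)) ⟩
  sum (map f (map (false ∷_) Ss) ++ map f (map (true ∷_) Ss))
    ≡⟨ sum-++ (map f (map (false ∷_) Ss)) (map f (map (true ∷_) Ss)) ⟩
  sum (map f (map (false ∷_) Ss)) + sum (map f (map (true ∷_) Ss))
    ≡⟨ cong₂ _+_ (cong sum (sym (map-∘ Ss))) (cong sum (sym (map-∘ Ss))) ⟩
  sum (map (λ S → f (false ∷ S)) Ss) + sum (map (λ S → f (true ∷ S)) Ss)
    ≡⟨ cong₂ _+_ (sum-allSubsets n (λ S → f (false ∷ S)))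
                 (sum-allSubsets n (λ S → f (true ∷ S))) ⟩
  Σₛ (λ S → f (false ∷ S)) + Σₛ (λ S → f (true ∷ S)) ∎
  where
  open ≡-Reasoning
  Ss = allSubsets n

sum-filter : ∀ {A : Set} (p : A → Bool) (h : A → ℕ) xs →
  sum (map h (filter (λ x → T? (p x)) xs)) ≡ sum (map (λ x → ⟦ p x ⟧ * h x) xs)
sum-filter p h []       = refl
sum-filter p h (x ∷ xs) with p x
... | true  = cong₂ _+_ (sym (ℕP.+-identityʳ (h x))) (sum-filter p h xs)
... | false = sum-filter p h xs

length-filter : ∀ {A : Set} (p : A → Bool) xs →
  length (filter (λ x → T? (p x)) xs) ≡ sum (map (λ x → ⟦ p x ⟧) xs)
length-filter p []       = refl
length-filter p (x ∷ xs) with p x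
... | true  = cong suc (length-filter p xs)
... | false = length-filter p xs

divℚ-≤ : ∀ a b N d (q : ℚ) → toℚᵘ q ≃ᵘ mkℚᵘ (+ N) d → a * suc d ≤ N * b → divℚ (+ a) b ≤ℚ q
divℚ-≤ a b N d q q≃ aD≤Nb = toℚᵘ-cancel-≤ (ℚᵘP.≤-respʳ-≃ (ℚᵘP.≃-sym q≃) (in-ℚᵘ b aD≤Nb))
  where
  in-ℚᵘ : ∀ b → a * suc d ≤ N * b → toℚᵘ (divℚ (+ a) b) ≤ᵘ mkℚᵘ (+ N) d
  in-ℚᵘ zero    _     = *≤* (subst₂ ℤ._≤_ (ℤP.pos-* 0 (suc d)) (ℤP.pos-* N 1) (ℤ.+≤+ z≤n))
  in-ℚᵘ (suc b) aD≤Nb =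
    ℚᵘP.≤-respˡ-≃ (ℚᵘP.≃-sym (toℚᵘ-fromℚᵘ (mkℚᵘ (+ a) b)))
      (*≤* (subst₂ ℤ._≤_ (ℤP.pos-* a (suc d)) (ℤP.pos-* N (suc b)) (ℤ.+≤+ aD≤Nb)))

bound-fraction : ∀ n δ e →
  toℚᵘ (divℚ (+ n) 2 *ℚ (1ℚ +ℚ divℚ (+ δ) (suc e))) ≃ᵘ mkℚᵘ (+ (n * (suc e + δ))) (pred (2 * suc e))
bound-fraction n δ e =
  ℚᵘP.≃-trans (toℚᵘ-homo-* (divℚ (+ n) 2) (1ℚ +ℚ divℚ (+ δ) (suc e)))
    (ℚᵘP.≃-trans
      (ℚᵘP.*-cong (toℚᵘ-fromℚᵘ (mkℚᵘ (+ n) 1))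
        (ℚᵘP.≃-trans (toℚᵘ-homo-+ 1ℚ (divℚ (+ δ) (suc e)))
          (ℚᵘP.+-cong (ℚᵘP.≃-refl {mkℚᵘ (+ 1) 0}) (toℚᵘ-fromℚᵘ (mkℚᵘ (+ δ) e)))))
      (*≡* (cong₂ ℤ._*_ numerator (sym denominator))))
  where
  open ≡-Reasoning
  numerator : ↥ (mkℚᵘ (+ n) 1 ᵘ* (mkℚᵘ (+ 1) 0 ᵘ+ mkℚᵘ (+ δ) e)) ≡ + (n * (suc e + δ))
  numerator = begin
    + n ℤ.* (+ 1 ℤ.* + suc e ℤ.+ + δ ℤ.* + 1)
      ≡⟨ cong₂ (λ x y → + n ℤ.* (x ℤ.+ y)) (ℤP.*-identityˡ (+ suc e)) (ℤP.*-identityʳ (+ δ)) ⟩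
    + n ℤ.* (+ suc e ℤ.+ + δ)
      ≡⟨ cong (+ n ℤ.*_) (sym (ℤP.pos-+ (suc e) δ)) ⟩
    + n ℤ.* + (suc e + δ)
      ≡⟨ sym (ℤP.pos-* n (suc e + δ)) ⟩
    + (n * (suc e + δ)) ∎
  denominator : ↧ (mkℚᵘ (+ n) 1 ᵘ* (mkℚᵘ (+ 1) 0 ᵘ+ mkℚᵘ (+ δ) e)) ≡ + (2 * suc e)
  denominator = cong (λ k → + suc k) (two-e e)
    where
    two-e : ∀ e → (e + 0 * suc e) + 1 * suc (e + 0 * suc e) ≡ e + suc (e + 0)
    two-e = solve-∀

module Domination {n : ℕ} (G : Graph n) where

  dom : Subset n → Bool
  dom = isDominating G

  dominatedBy : Subset n → Fin n → Bool
  dominatedBy S w = lookup S w ∨ anyV (λ u → lookup S u ∧ adj G u w)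

  dom-upClosed : UpClosed dom
  dom-upClosed S T S⊆T domS = all-intro (dominatedBy T) (λ w → still w (all-elim _ domS w))
    where
    via : ∀ w u → (lookup S u ∧ adj G u w) ≡ true → dominatedBy T w ≡ true
    via w u u∈S∧u~w = trans (cong (lookup T w ∨_) (any-intro _ u u∈T∧u~w)) (∨-zeroʳ (lookup T w))
      where
      u∈T∧u~w : (lookup T u ∧ adj G u w) ≡ true
      u∈T∧u~w = trans (cong (_∧ adj G u w) (S⊆T u (∧-conicalˡ _ _ u∈S∧u~w)))
                      (∧-conicalʳ (lookup S u) _ u∈S∧u~w)
    still : ∀ w → dominatedBy S w ≡ true → dominatedBy T w ≡ true
    still w byS with lookup S w in w∈S
    ... | true rewrite S⊆T w w∈S = refl
    ... | false with any-witness _ byS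
    ...   | u , u∈S∧u~w = via w u u∈S∧u~w

  N : Fin n → Subset n
  N u = tabulate (adj G u)

  N-lookup : ∀ u w → lookup (N u) w ≡ adj G u w
  N-lookup u w = lookup∘tabulate (adj G u) w

  N∩-lookup : ∀ u S w → lookup (N u ∩ S) w ≡ (adj G u w ∧ lookup S w)
  N∩-lookup u S w = trans (lookup-zipWith _∧_ w (N u) S) (cong (_∧ lookup S w) (N-lookup u w))

  ∣N∣≡deg : ∀ u → ∣ N u ∣ ≡ deg G u
  ∣N∣≡deg u = ∣tabulate∣ (adj G u)

  self∉N : ∀ u → lookup (N u) u ≡ false
  self∉N u = trans (N-lookup u u) (irrefl G u)

  _−_ : Subset n → Fin n → Subset n
  S − v = S [ v ]≔ false

  critical : Fin n → Subset n → Bool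
  critical v S = lookup S v ∧ dom S ∧ not (dom (S − v))

  only-v : ∀ S v w → dominatedBy (S − v) w ≡ false →
    ∀ x → x ≢ v → (adj G w x ∧ lookup S x) ≡ false
  only-v S v w undominated x x≢v = begin
    adj G w x ∧ lookup S x        ≡⟨ ∧-comm (adj G w x) (lookup S x) ⟩
    lookup S x ∧ adj G w x        ≡⟨ cong₂ _∧_ (sym (lookup∘update′ x≢v S false)) (symm G w x) ⟩
    lookup (S − v) x ∧ adj G x w  ≡⟨ any-false _ (∨-conicalʳ _ _ undominated) x ⟩
    false                         ∎
    where open ≡-Reasoning

  data Reason (v : Fin n) (S : Subset n) : Set where
    no-neighbour      : (∣ N v ∩ S ∣ ≡ᵇ 0) ≡ true → Reason v S
    private-neighbour : ∀ w → lookup S w ≡ false → isSingleton (N w ∩ S) v ≡ true → Reason v S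

  self-undominated : ∀ S v → dominatedBy (S − v) v ≡ false → Reason v S
  self-undominated S v undominated = no-neighbour (empty-intro (N v ∩ S) none)
    where
    none : ∀ x → lookup (N v ∩ S) x ≡ false
    none x with x FinP.≟ v
    ... | yes refl = trans (N∩-lookup v S v) (cong (_∧ lookup S v) (irrefl G v))
    ... | no x≢v   = trans (N∩-lookup v S x) (only-v S v v undominated x x≢v)

  other-undominated : ∀ S v w → w ≢ v → lookup S v ≡ true → dom S ≡ true →
    dominatedBy (S − v) w ≡ false → Reason v S
  other-undominated S v w w≢v v∈S domS undominated =
    private-neighbour w w∉S (singleton-intro (N w ∩ S) v v∈N[w]∩S unique)
    where
    open ≡-Reasoning
    w∉S : lookup S w ≡ false
    w∉S = trans (sym (lookup∘update′ w≢v S false)) (∨-conicalˡ _ _ undominated)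
    -- S dominates w, and only v can do so
    v~w : adj G v w ≡ true
    v~w with any-witness _ (subst (λ b → (b ∨ anyV (λ u → lookup S u ∧ adj G u w)) ≡ true) w∉S
                                  (all-elim _ domS w))
    ... | u , u∈S∧u~w with u FinP.≟ v
    ...   | yes refl = ∧-conicalʳ _ _ u∈S∧u~w
    ...   | no u≢v   = ⊥-elim (true≢false (begin
      true                    ≡⟨ sym u∈S∧u~w ⟩
      lookup S u ∧ adj G u w  ≡⟨ ∧-comm (lookup S u) _ ⟩
      adj G u w ∧ lookup S u  ≡⟨ cong (_∧ lookup S u) (symm G u w) ⟩
      adj G w u ∧ lookup S u  ≡⟨ only-v S v w undominated u u≢v ⟩
      false                   ∎))
    v∈N[w]∩S : lookup (N w ∩ S) v ≡ true
    v∈N[w]∩S = trans (N∩-lookup w S v) (cong₂ _∧_ (trans (symm G w v) v~w) v∈S)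
    unique : ∀ x → lookup (N w ∩ S) x ≡ true → x ≡ v
    unique x x∈ with x FinP.≟ v
    ... | yes x≡v = x≡v
    ... | no x≢v  = ⊥-elim (true≢false (begin
      true                    ≡⟨ sym x∈ ⟩
      lookup (N w ∩ S) x      ≡⟨ N∩-lookup w S x ⟩
      adj G w x ∧ lookup S x  ≡⟨ only-v S v w undominated x x≢v ⟩
      false                   ∎))

  critical-reason : ∀ v S → critical v S ≡ true → Reason v S
  critical-reason v S crit with lookup S v in v∈S | dom S in domS | dom (S − v) in domS−v
  ... | true | true | false with all-counterexample (dominatedBy (S − v)) domS−v
  ...   | w , undominated with w FinP.≟ v
  ...     | yes refl = self-undominated S v undominated
  ...     | no w≢v   = other-undominated S v w w≢v v∈S domS undominated

  domWith domWithout : Fin n → Subset n → Bool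
  domWith    v S = lookup S v ∧ dom S
  domWithout v S = not (lookup S v) ∧ dom S

  critical⇒dom : ∀ v S → critical v S ≡ true → dom S ≡ true
  critical⇒dom v S crit = ∧-conicalˡ _ _ (∧-conicalʳ (lookup S v) _ crit)

  critical⇒domWith : ∀ v S → critical v S ≡ true → domWith v S ≡ true
  critical⇒domWith v S crit =
    cong₂ _∧_ (∧-conicalˡ (lookup S v) _ crit) (critical⇒dom v S crit)

  -- Each critical pair (v, S) is charged either to v itself (no neighbour of
  -- v in S) or to a private neighbour w of v, which has exactly one neighbour in S.
  critical-charge : ∀ v S → ⟦ critical v S ⟧ ≤
    ⟦ domWith v S ⟧ * ⟦ ∣ N v ∩ S ∣ ≡ᵇ 0 ⟧
      + ∑[ w < n ] (⟦ domWithout w S ⟧ * ⟦ isSingleton (N w ∩ S) v ⟧)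
  critical-charge v S with critical v S in crit
  ... | false = z≤n
  ... | true with critical-reason v S crit
  ...   | no-neighbour isolated = ℕP.≤-trans (ℕP.≤-reflexive (sym charge≡1)) (ℕP.m≤m+n _ _)
    where
    charge≡1 : ⟦ domWith v S ⟧ * ⟦ ∣ N v ∩ S ∣ ≡ᵇ 0 ⟧ ≡ 1
    charge≡1 = cong₂ (λ a b → ⟦ a ⟧ * ⟦ b ⟧) (critical⇒domWith v S crit) isolated
  ...   | private-neighbour w w∉S single = ℕP.≤-trans charged (ℕP.m≤n+m _ _)
    where
    charge : ℕ
    charge = ⟦ domWithout w S ⟧ * ⟦ isSingleton (N w ∩ S) v ⟧
    charge≡1 : charge ≡ 1
    charge≡1 = trans (cong₂ (λ a b → ⟦ not a ∧ b ⟧ * ⟦ isSingleton (N w ∩ S) v ⟧)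
                            w∉S (critical⇒dom v S crit))
                     (trans (ℕP.*-identityˡ _) (cong ⟦_⟧ single))
    charged : 1 ≤ ∑[ x < n ] (⟦ domWithout x S ⟧ * ⟦ isSingleton (N x ∩ S) v ⟧)
    charged = ℕP.≤-trans (ℕP.≤-reflexive (sym charge≡1))
                         (∑-term (λ x → ⟦ domWithout x S ⟧ * ⟦ isSingleton (N x ∩ S) v ⟧) w)

  -- Summed over v: every w with exactly one neighbour in S is charged once.
  critical-total : ∀ S → ∑[ v < n ] ⟦ critical v S ⟧ ≤
    ∑[ v < n ] (⟦ domWith v S ⟧ * ⟦ ∣ N v ∩ S ∣ ≡ᵇ 0 ⟧)
      + ∑[ w < n ] (⟦ domWithout w S ⟧ * ⟦ ∣ N w ∩ S ∣ ≡ᵇ 1 ⟧)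
  critical-total S = begin
    ∑[ v < n ] ⟦ critical v S ⟧
      ≤⟨ ∑-mono (λ v → critical-charge v S) ⟩
    ∑[ v < n ] (iso v + ∑[ w < n ] priv w v)
      ≡⟨ ∑-distrib-+ iso (λ v → ∑[ w < n ] priv w v) ⟩
    ∑[ v < n ] iso v + ∑[ v < n ] ∑[ w < n ] priv w v
      ≡⟨ cong (_+_ (∑[ v < n ] iso v)) (trans (∑-comm (λ v w → priv w v)) (sum-cong-≗ once)) ⟩
    ∑[ v < n ] iso v + ∑[ w < n ] (⟦ domWithout w S ⟧ * ⟦ ∣ N w ∩ S ∣ ≡ᵇ 1 ⟧) ∎
    where
    open ℕP.≤-Reasoning
    iso : Fin n → ℕ
    iso v = ⟦ domWith v S ⟧ * ⟦ ∣ N v ∩ S ∣ ≡ᵇ 0 ⟧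
    priv : Fin n → Fin n → ℕ
    priv w v = ⟦ domWithout w S ⟧ * ⟦ isSingleton (N w ∩ S) v ⟧
    once : ∀ w → ∑[ v < n ] priv w v ≡ ⟦ domWithout w S ⟧ * ⟦ ∣ N w ∩ S ∣ ≡ᵇ 1 ⟧
    once w = trans (sym (*-distribˡ-sum ⟦ domWithout w S ⟧ (λ v → ⟦ isSingleton (N w ∩ S) v ⟧)))
                   (cong (⟦ domWithout w S ⟧ *_) (∑-isSingleton (N w ∩ S)))

  M A : ℕ
  M = Σₛ (λ S → ⟦ dom S ⟧)
  A = Σₛ (λ S → ⟦ dom S ⟧ * ∣ S ∣)

  having lacking criticalFor : Fin n → ℕ
  having      v = Σₛ (λ S → ⟦ domWith v S ⟧)
  lacking     v = Σₛ (λ S → ⟦ domWithout v S ⟧)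
  criticalFor v = Σₛ (λ S → ⟦ critical v S ⟧)

  -- Double counting the pairs (v, S) with v ∈ S.
  total-size : A ≡ ∑[ v < n ] having v
  total-size = trans (Σₛ-cong per-set) (Σₛ-∑-comm (λ v S → ⟦ domWith v S ⟧))
    where
    per-set : ∀ S → ⟦ dom S ⟧ * ∣ S ∣ ≡ ∑[ v < n ] ⟦ domWith v S ⟧
    per-set S = begin
      ⟦ dom S ⟧ * ∣ S ∣                            ≡⟨ cong (⟦ dom S ⟧ *_) (∣S∣-∑ S) ⟩
      ⟦ dom S ⟧ * ∑[ v < n ] ⟦ lookup S v ⟧        ≡⟨ *-distribˡ-sum ⟦ dom S ⟧ (λ v → ⟦ lookup S v ⟧) ⟩
      ∑[ v < n ] (⟦ dom S ⟧ * ⟦ lookup S v ⟧)      ≡⟨ sum-cong-≗ (λ v → trans (ℕP.*-comm ⟦ dom S ⟧ _)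
                                                                        (sym (⟦∧⟧ (lookup S v) (dom S)))) ⟩
      ∑[ v < n ] ⟦ domWith v S ⟧                  ∎
      where open ≡-Reasoning

  split-at : ∀ v → M ≡ having v + lacking v
  split-at v = trans (Σₛ-cong per-set) (Σₛ-+ (λ S → ⟦ domWith v S ⟧) (λ S → ⟦ domWithout v S ⟧))
    where
    per-set : ∀ S → ⟦ dom S ⟧ ≡ ⟦ domWith v S ⟧ + ⟦ domWithout v S ⟧
    per-set S with lookup S v
    ... | true  = sym (ℕP.+-identityʳ _)
    ... | false = refl

  delete-⊆ : ∀ S v → (S − v) ⊆ S
  delete-⊆ S v w w∈S−v with w FinP.≟ v
  ... | yes refl = ⊥-elim (true≢false (trans (sym w∈S−v) (lookup∘update w S false)))
  ... | no w≢v   = trans (sym (lookup∘update′ w≢v S false)) w∈S−v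

  -- Deleting v maps the non-critical dominating sets containing v
  -- bijectively onto the dominating sets avoiding v.
  having≡lacking+critical : ∀ v → having v ≡ lacking v + criticalFor v
  having≡lacking+critical v = begin
    having v
      ≡⟨ Σₛ-cong per-set ⟩
    Σₛ (λ S → ⟦ lookup S v ⟧ * ⟦ dom (S − v) ⟧ + ⟦ critical v S ⟧)
      ≡⟨ Σₛ-+ _ (λ S → ⟦ critical v S ⟧) ⟩
    Σₛ (λ S → ⟦ lookup S v ⟧ * ⟦ dom (S − v) ⟧) + criticalFor v
      ≡⟨ cong (_+ criticalFor v) (sym (Σₛ-delete v (λ S → ⟦ dom S ⟧))) ⟩
    Σₛ (λ S → ⟦ not (lookup S v) ⟧ * ⟦ dom S ⟧) + criticalFor v
      ≡⟨ cong (_+ criticalFor v) (Σₛ-cong (λ S → sym (⟦∧⟧ (not (lookup S v)) (dom S)))) ⟩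
    lacking v + criticalFor v ∎
    where
    open ≡-Reasoning
    per-set : ∀ S → ⟦ domWith v S ⟧ ≡ ⟦ lookup S v ⟧ * ⟦ dom (S − v) ⟧ + ⟦ critical v S ⟧
    per-set S with lookup S v
    ... | false = refl
    ... | true with dom (S − v) in dom[S−v]
    ...   | true rewrite dom-upClosed (S − v) S (delete-⊆ S v) dom[S−v] = refl
    ...   | false = cong ⟦_⟧ (sym (∧-identityʳ (dom S)))

  -- Membership of v is constant on the fibres over N v (as v ∉ N v), and
  -- domination is up-closed; so these families are up-closed along N v.
  upClosedAlong-N : ∀ v (φ : Bool → Bool) → UpClosedAlong (N v) (λ S → φ (lookup S v) ∧ dom S)
  upClosedAlong-N v φ R X Y X⊆Y inX = begin
    φ (lookup (embed (N v) R Y) v) ∧ dom (embed (N v) R Y)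
      ≡⟨ cong₂ _∧_ (cong φ (trans (outside Y) (sym (outside X))))
                   (dom-upClosed (embed (N v) R X) (embed (N v) R Y) (embed-mono (N v) R X Y X⊆Y)
                                 (∧-conicalʳ (φ (lookup (embed (N v) R X) v)) _ inX)) ⟩
    φ (lookup (embed (N v) R X) v) ∧ true
      ≡⟨ ∧-identityʳ _ ⟩
    φ (lookup (embed (N v) R X) v)
      ≡⟨ ∧-conicalˡ _ _ inX ⟩
    true ∎
    where
    open ≡-Reasoning
    outside : ∀ X → lookup (embed (N v) R X) v ≡ lookup R v
    outside X = embed-outside (N v) R X v (self∉N v)

  isolatedAt privateAt touchedAt : Fin n → ℕ
  isolatedAt v = avoiding    (N v) (domWith v)
  privateAt  w = meetingOnce (N w) (domWithout w)
  touchedAt  w = meeting     (N w) (domWithout w)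

  critical-count : ∑[ v < n ] criticalFor v ≤ ∑[ v < n ] isolatedAt v + ∑[ w < n ] privateAt w
  critical-count = begin
    ∑[ v < n ] criticalFor v
      ≡⟨ sym (Σₛ-∑-comm (λ v S → ⟦ critical v S ⟧)) ⟩
    Σₛ (λ S → ∑[ v < n ] ⟦ critical v S ⟧)
      ≤⟨ Σₛ-mono critical-total ⟩
    Σₛ (λ S → ∑[ v < n ] iso v S + ∑[ w < n ] priv w S)
      ≡⟨ Σₛ-+ (λ S → ∑[ v < n ] iso v S) (λ S → ∑[ w < n ] priv w S) ⟩
    Σₛ (λ S → ∑[ v < n ] iso v S) + Σₛ (λ S → ∑[ w < n ] priv w S)
      ≡⟨ cong₂ _+_ (Σₛ-∑-comm iso) (Σₛ-∑-comm priv) ⟩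
    ∑[ v < n ] isolatedAt v + ∑[ w < n ] privateAt w ∎
    where
    open ℕP.≤-Reasoning
    iso priv : Fin n → Subset n → ℕ
    iso  v S = ⟦ domWith v S ⟧ * ⟦ ∣ N v ∩ S ∣ ≡ᵇ 0 ⟧
    priv w S = ⟦ domWithout w S ⟧ * ⟦ ∣ N w ∩ S ∣ ≡ᵇ 1 ⟧

  isolated-bound : ∀ δ v → δ ≤ deg G v → isolatedAt v * 2 ^ δ ≤ having v
  isolated-bound δ v δ≤deg =
    ℕP.≤-trans (ℕP.*-monoʳ-≤ (isolatedAt v) (ℕP.^-monoʳ-≤ 2 (subst (δ ≤_) (sym (∣N∣≡deg v)) δ≤deg)))
               (avoiding-bound (N v) (domWith v) (upClosedAlong-N v (λ b → b)))

  private-bound : ∀ δ w → 1 ≤ δ → δ ≤ deg G w → privateAt w * 2 ^ δ ≤ δ * touchedAt w + privateAt w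
  private-bound δ w 1≤δ δ≤deg =
    lower-dimension (privateAt w) (touchedAt w) ∣ N w ∣ δ 1≤δ (subst (δ ≤_) (sym (∣N∣≡deg w)) δ≤deg)
      (meetingOnce-bound (N w) (domWithout w) (upClosedAlong-N w not))

  touched≤lacking : ∀ w → touchedAt w ≤ lacking w
  touched≤lacking w = Σₛ-mono (λ S → ℕP.≤-trans (ℕP.*-monoʳ-≤ ⟦ domWithout w S ⟧ (⟦⟧≤1 _))
                                                 (ℕP.≤-reflexive (ℕP.*-identityʳ _)))

  main-inequality : ∀ δ E → 1 ≤ δ → 2 ^ δ ≡ suc E → (∀ v → δ ≤ deg G v) →
    A * (2 * E) ≤ n * (E + δ) * M
  main-inequality δ E 1≤δ 2^δ≡ δ≤deg =
    combine A (∑ criticalFor) (∑ lacking) (∑ isolatedAt) (∑ privateAt) (∑ touchedAt) M n δ E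
      A≡ nM≡ critical-count I-bound P-bound (∑-mono touched≤lacking) 1≤δ
    where
    A≡ : A ≡ ∑ lacking + ∑ criticalFor
    A≡ = begin
      A                               ≡⟨ total-size ⟩
      ∑ having                        ≡⟨ sum-cong-≗ having≡lacking+critical ⟩
      ∑[ v < n ] (lacking v + criticalFor v) ≡⟨ ∑-distrib-+ lacking criticalFor ⟩
      ∑ lacking + ∑ criticalFor       ∎
      where open ≡-Reasoning
    nM≡ : n * M ≡ A + ∑ lacking
    nM≡ = begin
      n * M                           ≡⟨ sym (∑-const n M) ⟩
      ∑[ v < n ] M                    ≡⟨ sum-cong-≗ split-at ⟩
      ∑[ v < n ] (having v + lacking v) ≡⟨ ∑-distrib-+ having lacking ⟩
      ∑ having + ∑ lacking            ≡⟨ cong (_+ ∑ lacking) (sym total-size) ⟩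
      A + ∑ lacking                   ∎
      where open ≡-Reasoning
    I-bound : ∑ isolatedAt * suc E ≤ A
    I-bound = begin
      ∑ isolatedAt * suc E              ≡⟨ cong (∑ isolatedAt *_) (sym 2^δ≡) ⟩
      ∑ isolatedAt * 2 ^ δ              ≡⟨ *-distribʳ-sum (2 ^ δ) isolatedAt ⟩
      ∑[ v < n ] (isolatedAt v * 2 ^ δ) ≤⟨ ∑-mono (λ v → isolated-bound δ v (δ≤deg v)) ⟩
      ∑ having                          ≡⟨ sym total-size ⟩
      A                                 ∎
      where open ℕP.≤-Reasoning
    P-bound : ∑ privateAt * suc E ≤ δ * ∑ touchedAt + ∑ privateAt
    P-bound = begin
      ∑ privateAt * suc E               ≡⟨ cong (∑ privateAt *_) (sym 2^δ≡) ⟩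
      ∑ privateAt * 2 ^ δ               ≡⟨ *-distribʳ-sum (2 ^ δ) privateAt ⟩
      ∑[ w < n ] (privateAt w * 2 ^ δ)  ≤⟨ ∑-mono (λ w → private-bound δ w 1≤δ (δ≤deg w)) ⟩
      ∑[ w < n ] (δ * touchedAt w + privateAt w)
                                        ≡⟨ ∑-distrib-+ (λ w → δ * touchedAt w) privateAt ⟩
      ∑[ w < n ] (δ * touchedAt w) + ∑ privateAt
                                        ≡⟨ cong (_+ ∑ privateAt) (sym (*-distribˡ-sum δ touchedAt)) ⟩
      δ * ∑ touchedAt + ∑ privateAt     ∎
      where open ℕP.≤-Reasoning

  avd≡ : avd G ≡ divℚ (+ A) M
  avd≡ = cong₂ (λ a m → divℚ (+ a) m)
    (trans (sum-filter dom ∣_∣ (allSubsets n)) (sum-allSubsets n (λ S → ⟦ dom S ⟧ * ∣ S ∣)))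
    (trans (length-filter dom (allSubsets n)) (sum-allSubsets n (λ S → ⟦ dom S ⟧)))

2^δ-form : ∀ δ → 1 ≤ δ → Σ ℕ (λ e → 2 ^ δ ≡ suc (suc e))
2^δ-form (suc d) _ with 2 ^ d | ℕP.m^n>0 2 d
... | suc k | _ = k + (k + 0) , cong suc (ℕP.+-suc k (k + 0))

corollary3p7 : ∀ (n : ℕ) (G : Graph n) (δ : ℕ) → IsMinDegree G δ → 1 ≤ δ →
    (avd G ≤ℚ divℚ (+ n) 2 *ℚ (1ℚ +ℚ divℚ (+ δ) (2 ^ δ ∸ 1)))
      × (n * n ≤ 2 ^ δ → avd G ≤ℚ divℚ (+ (n + 1)) 2)
corollary3p7 n G δ (δ≤deg , (v , deg≡δ)) 1≤δ with 2^δ-form δ 1≤δ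
... | e , 2^δ≡ = part1 , part2
  where
  open Domination G
  E = suc e
  main : A * (2 * E) ≤ n * (E + δ) * M
  main = main-inequality δ E 1≤δ 2^δ≡ δ≤deg
  part1 : avd G ≤ℚ divℚ (+ n) 2 *ℚ (1ℚ +ℚ divℚ (+ δ) (2 ^ δ ∸ 1))
  part1 = subst₂ (λ a E′ → a ≤ℚ divℚ (+ n) 2 *ℚ (1ℚ +ℚ divℚ (+ δ) E′))
                 (sym avd≡) (cong (_∸ 1) (sym 2^δ≡))
                 (divℚ-≤ A M _ _ _ (bound-fraction n δ e) main)
  -- a vertex of degree δ misses itself, so δ < n
  δ<n : suc δ ≤ n
  δ<n = subst (λ d → suc d ≤ n) (trans (∣N∣≡deg v) deg≡δ) (missing⇒∣S∣<n (N v) v (self∉N v))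
  part2 : n * n ≤ 2 ^ δ → avd G ≤ℚ divℚ (+ (n + 1)) 2
  part2 n²≤ = subst (_≤ℚ divℚ (+ (n + 1)) 2) (sym avd≡)
    (divℚ-≤ A M (n + 1) 1 _ (toℚᵘ-fromℚᵘ (mkℚᵘ (+ (n + 1)) 1))
      (halve A M n δ E main (square-bound n δ E δ<n (subst (n * n ≤_) 2^δ≡ n²≤)) (s≤s z≤n)))
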